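{- Let $\alpha,\gamma_0\in\mathbb{Q}$ with $n+\alpha\ne0$ and $n+\gamma_0\neq0$ for all integers $n\ge 0$, and let $\beta_0=\alpha+\gamma_0$. Let $(u_n)_{n\ge-1}$ be a non-trivial solution of $(n+\alpha)u_n=(2n+\beta_0)u_{n-1}-(n+\gamma_0)u_{n-2}$ $(n\ge1)$. If $\alpha\le\gamma_0+1$, then $(u_n)$ is minimal if and only if $u_0/u_{ -1}=1$. If $\alpha>\gamma_0+1$, then $(u_n)$ is minimal if and only if $u_0/u_{ -1}=\frac{\gamma_0+1}{\alpha}$.
   Context: A non-trivial solution is minimal if some linearly independent solution $(v_n)$ of the same recurrence satisfies $u_n/v_n\to0$.
   Formalization: The solutions (u_n), and the linearly independent solutions (v_n) in the definition of minimality, are only rational-valued sequences rather than real-valued ones. -}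

module Defs where

open import Data.Nat as ℕ using (ℕ; suc; _≥_)
open import Data.Integer using (+_)
open import Data.Rational using (ℚ; 0ℚ; 1ℚ; _+_; _*_; _-_; ∣_∣; _<_; _/_)
open import Data.Product using (Σ; _×_; ∃)
open import Relation.Binary.PropositionalEquality using (_≡_)
open import Relation.Nullary using (¬_)

ℕ→ℚ : ℕ → ℚ
ℕ→ℚ n = + n / 1

-- A sequence (u_n)_{n ≥ -1} is encoded as  u : ℕ → ℚ  with  u k = u_{k-1}.  Writing n = suc m, u_n = u (m+2), u_{n-1} = u (m+1),
-- u_{n-2} = u m.
IsSolution : ℚ → ℚ → (ℕ → ℚ) → Set
IsSolution α γ₀ u =
  ∀ (m : ℕ) →
    (ℕ→ℚ (suc m) + α) * u (suc (suc m))
      ≡ (ℕ→ℚ (2 ℕ.* suc m) + (α + γ₀)) * u (suc m) - (ℕ→ℚ (suc m) + γ₀) * u m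

NonTrivial : (ℕ → ℚ) → Set
NonTrivial u = ¬ (∀ n → u n ≡ 0ℚ)

LinIndep : (ℕ → ℚ) → (ℕ → ℚ) → Set
LinIndep u v = ∀ (a b : ℚ) → (∀ n → a * u n + b * v n ≡ 0ℚ) → (a ≡ 0ℚ × b ≡ 0ℚ)

-- u_n / v_n → 0 : for every ε > 0, eventually v_n ≠ 0 and |u_n / v_n| < ε,
-- written multiplied out as |u_n| < ε |v_n| (which forces v_n ≠ 0).
RatioTendsToZero : (ℕ → ℚ) → (ℕ → ℚ) → Set
RatioTendsToZero u v =
  ∀ (ε : ℚ) → 0ℚ < ε → ∃ λ (N : ℕ) → ∀ n → n ≥ N → ∣ u n ∣ < ε * ∣ v n ∣

Minimal : ℚ → ℚ → (ℕ → ℚ) → Set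
Minimal α γ₀ u = ∃ λ (v : ℕ → ℚ) → IsSolution α γ₀ v × LinIndep u v × RatioTendsToZero u v

-- The constant sequence solves the recurrence, which is a first-order recurrence
-- (n+α) d_n = (n+γ₀) d_{n−1} for the differences d_n = u_n − u_{n−1}. A second solution is
-- P_k = α (γ₀+1)_k / (α)_k, whose consecutive ratios are 1 + (γ₀+1−α)/(k+α). Comparing the product
-- of these ratios with the divergent harmonic series shows that |P| → ∞ if α < γ₀+1 and P → 0 if
-- α > γ₀+1; if α = γ₀+1 then P is constant and the harmonic sums Q_k = ∑_{i<k} 1/(i+α) form an
-- unbounded solution instead. In every case this exhibits solutions m, w with m = o(w) (m = 1 when
-- α ≤ γ₀+1, m = P otherwise), and then u is minimal iff it is a non-zero multiple of m: writing
-- u and a competitor v in the basis (m, w), u = o(v) forces the w-coefficient of u to vanish.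

module Submission where

open import Defs
open import Data.Nat as ℕ using (ℕ; suc; zero)
import Data.Nat.Properties as ℕ
open import Data.Integer as ℤ using (-[1+_])
import Data.Integer.Properties as ℤ
import Data.Nat.Coprimality as Coprime
open import Data.Rational
open import Data.Rational.Properties
import Data.Rational.Unnormalised as ℚᵘ
import Data.Rational.Unnormalised.Properties as ℚᵘ
open import Data.Maybe using (Maybe; just; nothing)
open import Data.Product using (∃; ∃₂; _×_; _,_; proj₁; proj₂; map₂)
open import Data.Sum using (inj₁; inj₂)
open import Data.Empty using (⊥-elim)
open import Function.Bundles using (_⇔_; mk⇔; Equivalence)
open import Relation.Nullary using (yes; no)
open import Relation.Binary.Definitions using (tri<; tri≈; tri>)
open import Relation.Binary.PropositionalEquality
open import Tactic.RingSolver using (solve-∀)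
open import Tactic.RingSolver.Core.AlmostCommutativeRing using (AlmostCommutativeRing; fromCommutativeRing)

ℚ-ring : AlmostCommutativeRing _ _
ℚ-ring = fromCommutativeRing +-*-commutativeRing 0≟
  where
  0≟ : ∀ p → Maybe (0ℚ ≡ p)
  0≟ p with 0ℚ ≟ p
  ... | yes 0≡p = just 0≡p
  ... | no _    = nothing

-- A total reciprocal with the junk value recip 0ℚ ≡ 0ℚ, so that no NonZero instances are carried around.
recip : ℚ → ℚ
recip p with p ≟ 0ℚ
... | yes _  = 0ℚ
... | no p≢0 = (1/ p) {{≢-nonZero p≢0}}

recip-inverseʳ : ∀ {p} → p ≢ 0ℚ → p * recip p ≡ 1ℚ
recip-inverseʳ {p} p≢0 with p ≟ 0ℚ
... | yes p≡0 = ⊥-elim (p≢0 p≡0)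
... | no p≢0′ = *-inverseʳ p {{≢-nonZero p≢0′}}

recip-pos : ∀ {p} → 0ℚ < p → 0ℚ < recip p
recip-pos {p} 0<p with p ≟ 0ℚ
... | yes p≡0 = ⊥-elim (<-irrefl (sym p≡0) 0<p)
... | no p≢0  = positive⁻¹ _ {{1/pos⇒pos p {{positive 0<p}}}}

recip-≢0 : ∀ {p} → p ≢ 0ℚ → recip p ≢ 0ℚ
recip-≢0 {p} p≢0 1/p≡0 = 1≢0 (trans (sym (recip-inverseʳ p≢0)) (trans (cong (p *_) 1/p≡0) (*-zeroʳ p)))

pos⇒≢0 : ∀ {p} → 0ℚ < p → p ≢ 0ℚ
pos⇒≢0 0<p p≡0 = <-irrefl (sym p≡0) 0<p

*-recip-cancelˡ : ∀ {p} q → p ≢ 0ℚ → p * (q * recip p) ≡ q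
*-recip-cancelˡ {p} q p≢0 = begin
  p * (q * recip p)  ≡⟨ swap p q (recip p) ⟩
  q * (p * recip p)  ≡⟨ cong (q *_) (recip-inverseʳ p≢0) ⟩
  q * 1ℚ             ≡⟨ *-identityʳ q ⟩
  q                  ∎
  where
  open ≡-Reasoning
  swap : ∀ a b c → a * (b * c) ≡ b * (a * c)
  swap = solve-∀ ℚ-ring

*-cancelˡ-≢0 : ∀ r {p q} → r ≢ 0ℚ → r * p ≡ r * q → p ≡ q
*-cancelˡ-≢0 r {p} {q} r≢0 rp≡rq = begin
  p                  ≡⟨ *-recip-cancelˡ p r≢0 ⟨
  r * (p * recip r)  ≡⟨ *-assoc r p (recip r) ⟨
  r * p * recip r    ≡⟨ cong (_* recip r) rp≡rq ⟩
  r * q * recip r    ≡⟨ *-assoc r q (recip r) ⟩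
  r * (q * recip r)  ≡⟨ *-recip-cancelˡ q r≢0 ⟩
  q                  ∎
  where open ≡-Reasoning

p*q≡0⇒q≡0 : ∀ {p q} → p ≢ 0ℚ → p * q ≡ 0ℚ → q ≡ 0ℚ
p*q≡0⇒q≡0 {p} p≢0 pq≡0 = *-cancelˡ-≢0 p p≢0 (trans pq≡0 (sym (*-zeroʳ p)))

≤-difference : ∀ {p q d} → 0ℚ ≤ d → p + d ≡ q → p ≤ q
≤-difference {p} {d = d} 0≤d p+d≡q =
  subst₂ _≤_ (+-identityʳ p) p+d≡q (+-monoʳ-≤ p 0≤d)

<-difference : ∀ {p q d} → 0ℚ < d → p + d ≡ q → p < q
<-difference {p} {d = d} 0<d p+d≡q =
  subst₂ _<_ (+-identityʳ p) p+d≡q (+-monoʳ-< p 0<d)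

p<q⇒0<q-p : ∀ {p q} → p < q → 0ℚ < q - p
p<q⇒0<q-p {p} {q} p<q = subst (_< q - p) (+-inverseʳ p) (+-monoˡ-< (- p) p<q)

p≤q⇒0≤q-p : ∀ {p q} → p ≤ q → 0ℚ ≤ q - p
p≤q⇒0≤q-p {p} {q} p≤q = subst (_≤ q - p) (+-inverseʳ p) (+-monoˡ-≤ (- p) p≤q)

*-pos : ∀ {p q} → 0ℚ < p → 0ℚ < q → 0ℚ < p * q
*-pos {p} {q} 0<p 0<q = positive⁻¹ _ {{pos*pos⇒pos p {{positive 0<p}} q {{positive 0<q}}}}

*-nonNeg : ∀ {p q} → 0ℚ ≤ p → 0ℚ ≤ q → 0ℚ ≤ p * q
*-nonNeg {p} {q} 0≤p 0≤q =
  nonNegative⁻¹ _ {{nonNeg*nonNeg⇒nonNeg p {{nonNegative 0≤p}} q {{nonNegative 0≤q}}}}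

*-monoˡ-≤ : ∀ {r p q} → 0ℚ ≤ r → p ≤ q → r * p ≤ r * q
*-monoˡ-≤ {r} 0≤r = *-monoˡ-≤-nonNeg r {{nonNegative 0≤r}}

*-monoˡ-< : ∀ {r p q} → 0ℚ < r → p < q → r * p < r * q
*-monoˡ-< {r} 0<r = *-monoʳ-<-pos r {{positive 0<r}}

*-cancelˡ-≤ : ∀ {r p q} → 0ℚ < r → r * p ≤ r * q → p ≤ q
*-cancelˡ-≤ {r} 0<r = *-cancelˡ-≤-pos r {{positive 0<r}}

∣p∣-pos : ∀ {p} → p ≢ 0ℚ → 0ℚ < ∣ p ∣
∣p∣-pos {p} p≢0 with <-cmp 0ℚ ∣ p ∣
... | tri< 0<∣p∣ _ _ = 0<∣p∣
... | tri≈ _ 0≡∣p∣ _ = ⊥-elim (p≢0 (∣p∣≡0⇒p≡0 p (sym 0≡∣p∣)))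
... | tri> _ _ ∣p∣<0 = ⊥-elim (<-irrefl refl (<-≤-trans ∣p∣<0 (0≤∣p∣ p)))

p≤∣p∣ : ∀ p → p ≤ ∣ p ∣
p≤∣p∣ p with ∣p∣≡p∨∣p∣≡-p p
... | inj₁ ∣p∣≡p  = ≤-reflexive (sym ∣p∣≡p)
... | inj₂ ∣p∣≡-p = ≤-difference (+-mono-≤ (0≤∣p∣ p) (0≤∣p∣ p)) (begin
  p + (∣ p ∣ + ∣ p ∣)      ≡⟨ cong (λ x → p + (∣ p ∣ + x)) ∣p∣≡-p ⟩
  p + (∣ p ∣ + - p)        ≡⟨ cancel p ∣ p ∣ ⟩
  ∣ p ∣                    ∎)
  where
  open ≡-Reasoning
  cancel : ∀ a b → a + (b + - a) ≡ b
  cancel = solve-∀ ℚ-ring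

∣p∣≡p-pos : ∀ {p} → 0ℚ < p → ∣ p ∣ ≡ p
∣p∣≡p-pos 0<p = 0≤p⇒∣p∣≡p (<⇒≤ 0<p)

*-cong-∣∣ : ∀ {a b x y} → 0ℚ < a → 0ℚ < b → a * x ≡ b * y → a * ∣ x ∣ ≡ b * ∣ y ∣
*-cong-∣∣ {a} {b} {x} {y} 0<a 0<b ax≡by = begin
  a * ∣ x ∣       ≡⟨ cong (_* ∣ x ∣) (∣p∣≡p-pos 0<a) ⟨
  ∣ a ∣ * ∣ x ∣   ≡⟨ ∣p*q∣≡∣p∣*∣q∣ a x ⟨
  ∣ a * x ∣       ≡⟨ cong ∣_∣ ax≡by ⟩
  ∣ b * y ∣       ≡⟨ ∣p*q∣≡∣p∣*∣q∣ b y ⟩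
  ∣ b ∣ * ∣ y ∣   ≡⟨ cong (_* ∣ y ∣) (∣p∣≡p-pos 0<b) ⟩
  b * ∣ y ∣       ∎
  where open ≡-Reasoning

recip-cross-≤ : ∀ {p q r s} → 0ℚ < r → 0ℚ < s → p * s ≤ q * r → p * recip r ≤ q * recip s
recip-cross-≤ {p} {q} {r} {s} 0<r 0<s ps≤qr = *-cancelˡ-≤ (*-pos 0<r 0<s) (begin
  r * s * (p * recip r)        ≡⟨ rearrange r s p (recip r) ⟩
  (r * recip r) * (p * s)      ≡⟨ cong (_* (p * s)) (recip-inverseʳ (pos⇒≢0 0<r)) ⟩
  1ℚ * (p * s)                 ≤⟨ *-monoˡ-≤ (<⇒≤ (positive⁻¹ 1ℚ)) ps≤qr ⟩
  1ℚ * (q * r)                 ≡⟨ cong (_* (q * r)) (recip-inverseʳ (pos⇒≢0 0<s)) ⟨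
  (s * recip s) * (q * r)      ≡⟨ rearrange s r q (recip s) ⟨
  s * r * (q * recip s)        ≡⟨ cong (_* (q * recip s)) (*-comm s r) ⟩
  r * s * (q * recip s)        ∎)
  where
  open ≤-Reasoning
  rearrange : ∀ a b c i → a * b * (c * i) ≡ (a * i) * (c * b)
  rearrange = solve-∀ ℚ-ring

recip-antimono-≤ : ∀ {p q} → 0ℚ < p → p ≤ q → recip q ≤ recip p
recip-antimono-≤ {p} {q} 0<p p≤q = subst₂ _≤_ (*-identityˡ (recip q)) (*-identityˡ (recip p))
  (recip-cross-≤ {1ℚ} {1ℚ} (<-≤-trans 0<p p≤q) 0<p
    (subst₂ _≤_ (sym (*-identityˡ p)) (sym (*-identityˡ q)) p≤q))

*-recip-cancelˡ′ : ∀ {K} ε x → 0ℚ < K → K * (ε * recip K * x) ≡ ε * x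
*-recip-cancelˡ′ {K} ε x 0<K = begin
  K * (ε * recip K * x)    ≡⟨ reassoc K ε (recip K) x ⟩
  K * (ε * recip K) * x    ≡⟨ cong (_* x) (*-recip-cancelˡ ε (pos⇒≢0 0<K)) ⟩
  ε * x                    ∎
  where
  open ≡-Reasoning
  reassoc : ∀ a b c d → a * (b * c * d) ≡ a * (b * c) * d
  reassoc = solve-∀ ℚ-ring

∣a*x+b*y∣≤[∣a∣+∣b∣]*∣y∣ : ∀ a b {x y} → ∣ x ∣ ≤ ∣ y ∣ → ∣ a * x + b * y ∣ ≤ (∣ a ∣ + ∣ b ∣) * ∣ y ∣
∣a*x+b*y∣≤[∣a∣+∣b∣]*∣y∣ a b {x} {y} ∣x∣≤∣y∣ = begin
  ∣ a * x + b * y ∣                  ≤⟨ ∣p+q∣≤∣p∣+∣q∣ (a * x) (b * y) ⟩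
  ∣ a * x ∣ + ∣ b * y ∣              ≡⟨ cong₂ _+_ (∣p*q∣≡∣p∣*∣q∣ a x) (∣p*q∣≡∣p∣*∣q∣ b y) ⟩
  ∣ a ∣ * ∣ x ∣ + ∣ b ∣ * ∣ y ∣      ≤⟨ +-monoˡ-≤ (∣ b ∣ * ∣ y ∣) (*-monoˡ-≤ (0≤∣p∣ a) ∣x∣≤∣y∣) ⟩
  ∣ a ∣ * ∣ y ∣ + ∣ b ∣ * ∣ y ∣      ≡⟨ *-distribʳ-+ (∣ y ∣) (∣ a ∣) (∣ b ∣) ⟨
  (∣ a ∣ + ∣ b ∣) * ∣ y ∣            ∎
  where open ≤-Reasoning

ℕ→ℚ≡mkℚ : ∀ n → ℕ→ℚ n ≡ mkℚ (ℤ.+ n) 0 (Coprime.sym (Coprime.1-coprimeTo n))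
ℕ→ℚ≡mkℚ n = ↥p/↧p≡p (mkℚ (ℤ.+ n) 0 (Coprime.sym (Coprime.1-coprimeTo n)))

ℕ→ℚ-+ : ∀ m n → ℕ→ℚ (m ℕ.+ n) ≡ ℕ→ℚ m + ℕ→ℚ n
ℕ→ℚ-+ m n = toℚᵘ-injective (begin
  toℚᵘ (ℕ→ℚ (m ℕ.+ n))                       ≡⟨ cong toℚᵘ (ℕ→ℚ≡mkℚ (m ℕ.+ n)) ⟩
  ℚᵘ.mkℚᵘ (ℤ.+ (m ℕ.+ n)) 0                   ≈⟨ ℚᵘ.*≡* integers ⟩
  ℚᵘ.mkℚᵘ (ℤ.+ m) 0 ℚᵘ.+ ℚᵘ.mkℚᵘ (ℤ.+ n) 0    ≡⟨ cong₂ (λ x y → toℚᵘ x ℚᵘ.+ toℚᵘ y) (ℕ→ℚ≡mkℚ m) (ℕ→ℚ≡mkℚ n) ⟨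
  toℚᵘ (ℕ→ℚ m) ℚᵘ.+ toℚᵘ (ℕ→ℚ n)              ≈⟨ toℚᵘ-homo-+ (ℕ→ℚ m) (ℕ→ℚ n) ⟨
  toℚᵘ (ℕ→ℚ m + ℕ→ℚ n)                        ∎)
  where
  open ℚᵘ.≃-Reasoning
  integers : ℤ.+ (m ℕ.+ n) ℤ.* ℤ.+ 1 ≡ (ℤ.+ m ℤ.* ℤ.+ 1 ℤ.+ ℤ.+ n ℤ.* ℤ.+ 1) ℤ.* ℤ.+ 1
  integers = cong (ℤ._* ℤ.+ 1) (trans (ℤ.pos-+ m n)
    (sym (cong₂ ℤ._+_ (ℤ.*-identityʳ (ℤ.+ m)) (ℤ.*-identityʳ (ℤ.+ n)))))

ℕ→ℚ-suc : ∀ n → ℕ→ℚ (suc n) ≡ ℕ→ℚ n + 1ℚ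
ℕ→ℚ-suc n = trans (cong ℕ→ℚ (ℕ.+-comm 1 n)) (ℕ→ℚ-+ n 1)

ℕ→ℚ-nonNeg : ∀ n → 0ℚ ≤ ℕ→ℚ n
ℕ→ℚ-nonNeg n = subst (0ℚ ≤_) (sym (ℕ→ℚ≡mkℚ n))
  (*≤* (subst (ℤ.+ 0 ℤ.≤_) (sym (ℤ.*-identityʳ (ℤ.+ n))) (ℤ.+≤+ ℕ.z≤n)))

archimedean : ∀ p → ∃ λ n → p < ℕ→ℚ n
archimedean p@(mkℚ (ℤ.+ k) d _) = suc k , subst (p <_) (sym (ℕ→ℚ≡mkℚ (suc k))) (*<* k*1<[1+k]*[1+d])
  where
  k*1<[1+k]*[1+d] : ℤ.+ k ℤ.* ℤ.+ 1 ℤ.< ℤ.+ suc k ℤ.* ℤ.+ suc d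
  k*1<[1+k]*[1+d] = subst₂ ℤ._<_ (ℤ.pos-* k 1) (ℤ.pos-* (suc k) (suc d))
    (ℤ.+<+ (ℕ.≤-trans (ℕ.s≤s (ℕ.≤-reflexive (ℕ.*-identityʳ k))) (ℕ.m≤m*n (suc k) (suc d))))
archimedean p@(mkℚ -[1+ _ ] _ _) = 0 , *<* ℤ.-<+

ℕ→ℚ-mono-≤ : ∀ {m n} → m ℕ.≤ n → ℕ→ℚ m ≤ ℕ→ℚ n
ℕ→ℚ-mono-≤ {m} {n} m≤n = ≤-difference (ℕ→ℚ-nonNeg (n ℕ.∸ m))
  (trans (sym (ℕ→ℚ-+ m (n ℕ.∸ m))) (cong ℕ→ℚ (ℕ.m+[n∸m]≡n m≤n)))

ℕ→ℚ-double : ∀ n → ℕ→ℚ (2 ℕ.* n) ≡ ℕ→ℚ n + ℕ→ℚ n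
ℕ→ℚ-double n = trans (cong ℕ→ℚ (cong (n ℕ.+_) (ℕ.+-identityʳ n))) (ℕ→ℚ-+ n n)

ℕ→ℚ-shift : ∀ j K a → ℕ→ℚ (j ℕ.+ K) + a ≡ ℕ→ℚ j + (ℕ→ℚ K + a)
ℕ→ℚ-shift j K a = trans (cong (_+ a) (ℕ→ℚ-+ j K)) (+-assoc (ℕ→ℚ j) (ℕ→ℚ K) a)

positive-shift : ∀ a → ∃ λ K → 0ℚ < ℕ→ℚ K + a
positive-shift a = K , subst (0ℚ <_) (double-neg (ℕ→ℚ K) a) (p<q⇒0<q-p -a<K)
  where
  K : ℕ
  K = proj₁ (archimedean (- a))
  -a<K : - a < ℕ→ℚ K
  -a<K = proj₂ (archimedean (- a))
  double-neg : ∀ k a → k - (- a) ≡ k + a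
  double-neg = solve-∀ ℚ-ring

shift-pos : ∀ {K a} → 0ℚ < ℕ→ℚ K + a → ∀ j → 0ℚ < ℕ→ℚ (j ℕ.+ K) + a
shift-pos {K} {a} 0<K+a j = subst (0ℚ <_) (sym (ℕ→ℚ-shift j K a)) (+-mono-≤-< (ℕ→ℚ-nonNeg j) 0<K+a)

Eventually : (ℕ → Set) → Set
Eventually P = ∃ λ N → ∀ n → N ℕ.≤ n → P n

eventually-map : ∀ {P Q : ℕ → Set} → (∀ {n} → P n → Q n) → Eventually P → Eventually Q
eventually-map f (N , P) = N , λ n N≤n → f (P n N≤n)

eventually-zip : ∀ {P Q : ℕ → Set} → Eventually P → Eventually Q → Eventually (λ n → P n × Q n)
eventually-zip (M , P) (N , Q) =
  M ℕ.⊔ N , λ n M⊔N≤n → P n (ℕ.m⊔n≤o⇒m≤o M N M⊔N≤n) , Q n (ℕ.m⊔n≤o⇒n≤o M N M⊔N≤n)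

eventually-unshift : ∀ {P : ℕ → Set} K → Eventually (λ j → P (j ℕ.+ K)) → Eventually P
eventually-unshift {P} K (N , P+K) = N ℕ.+ K , λ n N+K≤n →
  subst P (ℕ.m∸n+n≡m (ℕ.≤-trans (ℕ.m≤n+m K N) N+K≤n))
    (P+K (n ℕ.∸ K) (subst (ℕ._≤ n ℕ.∸ K) (ℕ.m+n∸n≡m N K) (ℕ.∸-monoˡ-≤ K N+K≤n)))

Unbounded : (ℕ → ℚ) → Set
Unbounded f = ∀ M → Eventually (λ n → M < f n)

unbounded-mono : ∀ {f g} → (∀ n → f n ≤ g n) → Unbounded f → Unbounded g
unbounded-mono f≤g f↑ M = eventually-map (λ {n} M<fn → <-≤-trans M<fn (f≤g n)) (f↑ M)

unbounded-+ˡ : ∀ {f} a → Unbounded f → Unbounded (λ n → a + f n)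
unbounded-+ˡ {f} a f↑ M = eventually-map step (f↑ (M - a))
  where
  step : ∀ {n} → M - a < f n → M < a + f n
  step {n} M-a<fn = <-difference (p<q⇒0<q-p M-a<fn) (lemma M a (f n))
    where
    lemma : ∀ m x y → m + (y - (m - x)) ≡ x + y
    lemma = solve-∀ ℚ-ring

unbounded-*ˡ : ∀ {f κ} → 0ℚ < κ → Unbounded f → Unbounded (λ n → κ * f n)
unbounded-*ˡ {f} {κ} 0<κ f↑ M = eventually-map step (f↑ (M * recip κ))
  where
  step : ∀ {n} → M * recip κ < f n → M < κ * f n
  step M/κ<fn = subst (_< _) (*-recip-cancelˡ M (pos⇒≢0 0<κ)) (*-monoˡ-< 0<κ M/κ<fn)

ℕ→ℚ-unbounded : Unbounded ℕ→ℚ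
ℕ→ℚ-unbounded M with archimedean M
... | N , M<N = N , λ n N≤n → <-≤-trans M<N (ℕ→ℚ-mono-≤ N≤n)

ratio-cong : ∀ {u u′ v : ℕ → ℚ} → (∀ n → u n ≡ u′ n) → RatioTendsToZero u v → RatioTendsToZero u′ v
ratio-cong {u} {u′} {v} u≡u′ u/v→0 ε 0<ε =
  eventually-map (λ {n} → subst (λ x → ∣ x ∣ < ε * ∣ v n ∣) (u≡u′ n)) (u/v→0 ε 0<ε)

ratio-*ˡ : ∀ {u v : ℕ → ℚ} c → RatioTendsToZero u v → RatioTendsToZero (λ n → c * u n) v
ratio-*ˡ {u} {v} c u/v→0 ε 0<ε = eventually-map step (u/v→0 ε′ (*-pos 0<ε (recip-pos 0<K)))
  where
  K : ℚ
  K = ∣ c ∣ + 1ℚ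
  0<K : 0ℚ < K
  0<K = +-mono-≤-< (0≤∣p∣ c) (positive⁻¹ 1ℚ)
  ε′ : ℚ
  ε′ = ε * recip K
  step : ∀ {n} → ∣ u n ∣ < ε′ * ∣ v n ∣ → ∣ c * u n ∣ < ε * ∣ v n ∣
  step {n} small = begin-strict
    ∣ c * u n ∣              ≡⟨ ∣p*q∣≡∣p∣*∣q∣ c (u n) ⟩
    ∣ c ∣ * ∣ u n ∣          ≤⟨ ≤-difference (0≤∣p∣ (u n)) (distrib (∣ c ∣) (∣ u n ∣)) ⟩
    K * ∣ u n ∣              <⟨ *-monoˡ-< 0<K small ⟩
    K * (ε′ * ∣ v n ∣)       ≡⟨ *-recip-cancelˡ′ ε (∣ v n ∣) 0<K ⟩
    ε * ∣ v n ∣              ∎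
    where
    open ≤-Reasoning
    distrib : ∀ a x → a * x + x ≡ (a + 1ℚ) * x
    distrib = solve-∀ ℚ-ring

ratio-+ : ∀ {u u′ w : ℕ → ℚ} → RatioTendsToZero u w → RatioTendsToZero u′ w →
          RatioTendsToZero (λ n → u n + u′ n) w
ratio-+ {u} {u′} {w} u/w→0 u′/w→0 ε 0<ε =
  eventually-map step (eventually-zip (u/w→0 ε′ 0<ε′) (u′/w→0 ε′ 0<ε′))
  where
  two : ℚ
  two = 1ℚ + 1ℚ
  0<two : 0ℚ < two
  0<two = +-mono-< (positive⁻¹ 1ℚ) (positive⁻¹ 1ℚ)
  ε′ : ℚ
  ε′ = ε * recip two
  0<ε′ : 0ℚ < ε′
  0<ε′ = *-pos 0<ε (recip-pos 0<two)
  step : ∀ {n} → ∣ u n ∣ < ε′ * ∣ w n ∣ × ∣ u′ n ∣ < ε′ * ∣ w n ∣ →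
         ∣ u n + u′ n ∣ < ε * ∣ w n ∣
  step {n} (small , small′) = begin-strict
    ∣ u n + u′ n ∣                   ≤⟨ ∣p+q∣≤∣p∣+∣q∣ (u n) (u′ n) ⟩
    ∣ u n ∣ + ∣ u′ n ∣               <⟨ +-mono-< small small′ ⟩
    ε′ * ∣ w n ∣ + ε′ * ∣ w n ∣      ≡⟨ double (ε′ * ∣ w n ∣) ⟩
    two * (ε′ * ∣ w n ∣)             ≡⟨ *-recip-cancelˡ′ ε (∣ w n ∣) 0<two ⟩
    ε * ∣ w n ∣                      ∎
    where
    open ≤-Reasoning
    double : ∀ x → x + x ≡ (1ℚ + 1ℚ) * x
    double = solve-∀ ℚ-ring

ratio-O-trans : ∀ {u v w : ℕ → ℚ} {C} → 0ℚ ≤ C → Eventually (λ n → ∣ v n ∣ ≤ C * ∣ w n ∣) →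
                RatioTendsToZero u v → RatioTendsToZero u w
ratio-O-trans {u} {v} {w} {C} 0≤C v≤Cw u/v→0 ε 0<ε =
  eventually-map step (eventually-zip (u/v→0 ε′ 0<ε′) v≤Cw)
  where
  K : ℚ
  K = C + 1ℚ
  0<K : 0ℚ < K
  0<K = +-mono-≤-< 0≤C (positive⁻¹ 1ℚ)
  ε′ : ℚ
  ε′ = ε * recip K
  0<ε′ : 0ℚ < ε′
  0<ε′ = *-pos 0<ε (recip-pos 0<K)
  step : ∀ {n} → ∣ u n ∣ < ε′ * ∣ v n ∣ × ∣ v n ∣ ≤ C * ∣ w n ∣ → ∣ u n ∣ < ε * ∣ w n ∣
  step {n} (small , bounded) = begin-strict
    ∣ u n ∣                  <⟨ small ⟩
    ε′ * ∣ v n ∣             ≤⟨ *-monoˡ-≤ (<⇒≤ 0<ε′) bounded ⟩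
    ε′ * (C * ∣ w n ∣)       ≤⟨ ≤-difference (*-nonNeg (<⇒≤ 0<ε′) (0≤∣p∣ (w n))) (distrib ε′ C (∣ w n ∣)) ⟩
    K * (ε′ * ∣ w n ∣)       ≡⟨ *-recip-cancelˡ′ ε (∣ w n ∣) 0<K ⟩
    ε * ∣ w n ∣              ∎
    where
    open ≤-Reasoning
    distrib : ∀ e c x → e * (c * x) + e * x ≡ (c + 1ℚ) * (e * x)
    distrib = solve-∀ ℚ-ring

ratio-*-self⇒≡0 : ∀ {c w} → RatioTendsToZero (λ n → c * w n) w → c ≡ 0ℚ
ratio-*-self⇒≡0 {c} {w} cw/w→0 with c ≟ 0ℚ
... | yes c≡0 = c≡0
... | no c≢0 with cw/w→0 ∣ c ∣ (∣p∣-pos c≢0)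
...   | N , small = ⊥-elim (<-irrefl (∣p*q∣≡∣p∣*∣q∣ c (w N)) (small N ℕ.≤-refl))

unbounded⇒ratio-1 : ∀ {q} → Unbounded (λ n → ∣ q n ∣) → RatioTendsToZero (λ _ → 1ℚ) q
unbounded⇒ratio-1 {q} ∣q∣↑ ε 0<ε = eventually-map step (∣q∣↑ (recip ε))
  where
  step : ∀ {n} → recip ε < ∣ q n ∣ → ∣ 1ℚ ∣ < ε * ∣ q n ∣
  step {n} 1/ε<∣qn∣ = subst (_< ε * ∣ q n ∣) (recip-inverseʳ (pos⇒≢0 0<ε)) (*-monoˡ-< 0<ε 1/ε<∣qn∣)

weighted-bound⇒small : ∀ {y f : ℕ → ℚ} {Z} → (∀ n → 0ℚ ≤ y n) → 0ℚ ≤ Z → Unbounded f →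
  (∀ n → y n * f n ≤ Z) → ∀ ε → 0ℚ < ε → Eventually (λ n → y n < ε)
weighted-bound⇒small {y} {f} {Z} 0≤y 0≤Z f↑ yf≤Z ε 0<ε = eventually-map step (f↑ (Z * recip ε))
  where
  step : ∀ {n} → Z * recip ε < f n → y n < ε
  step {n} Z/ε<fn with y n <? ε
  ... | yes yn<ε = yn<ε
  ... | no yn≮ε = ⊥-elim (<-irrefl refl (begin-strict
    Z                    ≡⟨ *-recip-cancelˡ Z (pos⇒≢0 0<ε) ⟨
    ε * (Z * recip ε)    <⟨ *-monoˡ-< 0<ε Z/ε<fn ⟩
    ε * f n              ≤⟨ *-monoʳ-≤-nonNeg (f n) {{nonNegative 0≤fn}} (≮⇒≥ yn≮ε) ⟩
    y n * f n            ≤⟨ yf≤Z n ⟩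
    Z                    ∎))
    where
    open ≤-Reasoning
    0≤fn : 0ℚ ≤ f n
    0≤fn = ≤-trans (*-nonNeg 0≤Z (<⇒≤ (recip-pos 0<ε))) (<⇒≤ Z/ε<fn)

recipSum : (ℕ → ℚ) → ℕ → ℚ
recipSum t zero    = 0ℚ
recipSum t (suc n) = recipSum t n + recip (t n)

recipSum-cong : ∀ {t t′} → (∀ i → t i ≡ t′ i) → ∀ n → recipSum t n ≡ recipSum t′ n
recipSum-cong t≡t′ zero    = refl
recipSum-cong t≡t′ (suc n) = cong₂ (λ s x → s + recip x) (recipSum-cong t≡t′ n) (t≡t′ n)

recipSum-shift : ∀ t K j → recipSum t (j ℕ.+ K) ≡ recipSum t K + recipSum (λ i → t (i ℕ.+ K)) j
recipSum-shift t K zero    = sym (+-identityʳ (recipSum t K))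
recipSum-shift t K (suc j) = trans (cong (_+ recip (t (j ℕ.+ K))) (recipSum-shift t K j))
  (+-assoc (recipSum t K) (recipSum (λ i → t (i ℕ.+ K)) j) (recip (t (j ℕ.+ K))))

module _ {t : ℕ → ℚ} (0<t : ∀ j → 0ℚ < t j) where

  recipSum-mono-≤ : ∀ {m n} → m ℕ.≤ n → recipSum t m ≤ recipSum t n
  recipSum-mono-≤ {m} {n} m≤n = subst (λ k → recipSum t m ≤ recipSum t k) (ℕ.m+[n∸m]≡n m≤n)
    (go (n ℕ.∸ m))
    where
    go : ∀ k → recipSum t m ≤ recipSum t (m ℕ.+ k)
    go zero    = ≤-reflexive (cong (recipSum t) (sym (ℕ.+-identityʳ m)))
    go (suc k) = ≤-trans (go k) (subst (λ i → recipSum t (m ℕ.+ k) ≤ recipSum t i) (sym (ℕ.+-suc m k))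
      (≤-difference (<⇒≤ (recip-pos (0<t (m ℕ.+ k)))) refl))

  recipSum-nonNeg : ∀ n → 0ℚ ≤ recipSum t n
  recipSum-nonNeg n = recipSum-mono-≤ {0} {n} ℕ.z≤n

  -- y j / y 0 is the product of the factors 1 + c / t i (i < j), which is at least 1 + c ∑ 1 / t i.
  recipSum-growth : ∀ {y : ℕ → ℚ} {c} → 0ℚ ≤ c → 0ℚ ≤ y 0 →
    (∀ j → t j * y (suc j) ≡ (t j + c) * y j) → ∀ j → y 0 * (1ℚ + c * recipSum t j) ≤ y j
  recipSum-growth {y} {c} 0≤c 0≤y₀ step zero = ≤-reflexive (base (y 0) c)
    where
    base : ∀ a c → a * (1ℚ + c * 0ℚ) ≡ a
    base = solve-∀ ℚ-ring
  recipSum-growth {y} {c} 0≤c 0≤y₀ step (suc j) = *-cancelˡ-≤ (0<t j) (begin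
    t j * (y 0 * (1ℚ + c * (S + recip (t j))))     ≡⟨ expand (t j) (y 0) c S (recip (t j)) ⟩
    y 0 * (t j + c * S * t j + c * (t j * recip (t j)))
                                                   ≡⟨ cong (λ x → y 0 * (t j + c * S * t j + c * x)) t/t≡1 ⟩
    y 0 * (t j + c * S * t j + c * 1ℚ)             ≤⟨ ≤-difference 0≤y₀c²S (regroup (t j) (y 0) c S) ⟩
    (t j + c) * (y 0 * (1ℚ + c * S))               ≤⟨ *-monoˡ-≤ 0≤t+c (recipSum-growth 0≤c 0≤y₀ step j) ⟩
    (t j + c) * y j                                ≡⟨ step j ⟨
    t j * y (suc j)                                ∎)
    where
    open ≤-Reasoning
    S : ℚ
    S = recipSum t j
    t/t≡1 : t j * recip (t j) ≡ 1ℚ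
    t/t≡1 = recip-inverseʳ (pos⇒≢0 (0<t j))
    0≤y₀c²S : 0ℚ ≤ y 0 * c * c * S
    0≤y₀c²S = *-nonNeg (*-nonNeg (*-nonNeg 0≤y₀ 0≤c) 0≤c) (recipSum-nonNeg j)
    0≤t+c : 0ℚ ≤ t j + c
    0≤t+c = +-mono-≤ (<⇒≤ (0<t j)) 0≤c
    expand : ∀ t a c S i → t * (a * (1ℚ + c * (S + i))) ≡ a * (t + c * S * t + c * (t * i))
    expand = solve-∀ ℚ-ring
    regroup : ∀ t a c S → a * (t + c * S * t + c * 1ℚ) + a * c * c * S ≡ (t + c) * (a * (1ℚ + c * S))
    regroup = solve-∀ ℚ-ring

  recipSum-decay : ∀ {y : ℕ → ℚ} {c} → 0ℚ ≤ c → (∀ j → 0ℚ ≤ y j) →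
    (∀ j → (t j + c) * y (suc j) ≡ t j * y j) → ∀ j → y j * (1ℚ + c * recipSum t j) ≤ y 0
  recipSum-decay {y} {c} 0≤c 0≤y step zero = ≤-reflexive (base (y 0) c)
    where
    base : ∀ a c → a * (1ℚ + c * 0ℚ) ≡ a
    base = solve-∀ ℚ-ring
  recipSum-decay {y} {c} 0≤c 0≤y step (suc j) = *-cancelˡ-≤ (0<t j) (begin
    t j * (y (suc j) * (1ℚ + c * (S + recip (t j))))
                                          ≡⟨ expand (t j) (y (suc j)) c S (recip (t j)) ⟩
    y (suc j) * (t j + c * (t j * recip (t j))) + c * S * (t j * y (suc j))
                                          ≡⟨ cong (λ x → y (suc j) * (t j + c * x) + c * S * (t j * y (suc j))) t/t≡1 ⟩
    y (suc j) * (t j + c * 1ℚ) + c * S * (t j * y (suc j))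
                                          ≡⟨ cong (_+ c * S * (t j * y (suc j))) (trans (flip (y (suc j)) (t j) c) (step j)) ⟩
    t j * y j + c * S * (t j * y (suc j)) ≤⟨ +-monoʳ-≤ (t j * y j) (*-monoˡ-≤ 0≤cS (*-monoˡ-≤ 0≤t decreasing)) ⟩
    t j * y j + c * S * (t j * y j)       ≡⟨ factor (t j) (y j) c S ⟩
    t j * (y j * (1ℚ + c * S))            ≤⟨ *-monoˡ-≤ 0≤t (recipSum-decay 0≤c 0≤y step j) ⟩
    t j * y 0                             ∎)
    where
    open ≤-Reasoning
    S : ℚ
    S = recipSum t j
    t/t≡1 : t j * recip (t j) ≡ 1ℚ
    t/t≡1 = recip-inverseʳ (pos⇒≢0 (0<t j))
    0≤t : 0ℚ ≤ t j
    0≤t = <⇒≤ (0<t j)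
    0≤cS : 0ℚ ≤ c * S
    0≤cS = *-nonNeg 0≤c (recipSum-nonNeg j)
    expand : ∀ t a c S i → t * (a * (1ℚ + c * (S + i))) ≡ a * (t + c * (t * i)) + c * S * (t * a)
    expand = solve-∀ ℚ-ring
    flip : ∀ a t c → a * (t + c * 1ℚ) ≡ (t + c) * a
    flip = solve-∀ ℚ-ring
    factor : ∀ t a c S → t * a + c * S * (t * a) ≡ t * (a * (1ℚ + c * S))
    factor = solve-∀ ℚ-ring
    0<t+c : 0ℚ < t j + c
    0<t+c = +-mono-<-≤ (0<t j) 0≤c
    decreasing : y (suc j) ≤ y j
    decreasing = *-cancelˡ-≤ 0<t+c (begin
      (t j + c) * y (suc j)   ≡⟨ step j ⟩
      t j * y j               ≤⟨ ≤-difference (*-nonNeg 0≤c (0≤y j)) (sym (*-distribʳ-+ (y j) (t j) c)) ⟩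
      (t j + c) * y j         ∎)

module Harmonic {β : ℚ} (0<β : 0ℚ < β) where

  H : ℕ → ℚ
  H = recipSum (λ j → ℕ→ℚ j + β)

  0<j+β : ∀ j → 0ℚ < ℕ→ℚ j + β
  0<j+β j = +-mono-≤-< (ℕ→ℚ-nonNeg j) 0<β

  -- The i terms of H (i + m) beyond H m are each at least 1 / (i + m + β).
  H-block : ∀ m i → H m + ℕ→ℚ i * recip (ℕ→ℚ (i ℕ.+ m) + β) ≤ H (i ℕ.+ m)
  H-block m zero    = ≤-reflexive (trans (cong (H m +_) (*-zeroˡ (recip (ℕ→ℚ m + β)))) (+-identityʳ (H m)))
  H-block m (suc i) = begin
    H m + ℕ→ℚ (suc i) * recip (ℕ→ℚ (suc i ℕ.+ m) + β)  ≤⟨ +-monoʳ-≤ (H m) (*-monoˡ-≤ (ℕ→ℚ-nonNeg (suc i)) x′≤x) ⟩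
    H m + ℕ→ℚ (suc i) * x                              ≡⟨ cong (λ k → H m + k * x) (ℕ→ℚ-suc i) ⟩
    H m + (ℕ→ℚ i + 1ℚ) * x                             ≡⟨ regroup (H m) (ℕ→ℚ i) x ⟩
    (H m + ℕ→ℚ i * x) + x                              ≤⟨ +-monoˡ-≤ x (H-block m i) ⟩
    H (suc i ℕ.+ m)                                    ∎
    where
    open ≤-Reasoning
    x : ℚ
    x = recip (ℕ→ℚ (i ℕ.+ m) + β)
    x′≤x : recip (ℕ→ℚ (suc i ℕ.+ m) + β) ≤ x
    x′≤x = recip-antimono-≤ (0<j+β (i ℕ.+ m)) (+-monoˡ-≤ β (ℕ→ℚ-mono-≤ (ℕ.n≤1+n (i ℕ.+ m))))
    regroup : ∀ h a x → h + (a + 1ℚ) * x ≡ (h + a * x) + x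
    regroup = solve-∀ ℚ-ring

  three : ℚ
  three = 1ℚ + 1ℚ + 1ℚ

  0<three : 0ℚ < three
  0<three = +-mono-< (+-mono-< (positive⁻¹ 1ℚ) (positive⁻¹ 1ℚ)) (positive⁻¹ 1ℚ)

  H-doubling : ∀ {m} → β ≤ ℕ→ℚ m → H m + recip three ≤ H (m ℕ.+ m)
  H-doubling {m} β≤m = ≤-trans (+-monoʳ-≤ (H m) third≤) (H-block m m)
    where
    third≤ : recip three ≤ ℕ→ℚ m * recip (ℕ→ℚ (m ℕ.+ m) + β)
    third≤ = subst (_≤ ℕ→ℚ m * recip (ℕ→ℚ (m ℕ.+ m) + β)) (*-identityˡ (recip three))
      (recip-cross-≤ {1ℚ} {ℕ→ℚ m} 0<three (0<j+β (m ℕ.+ m)) 2m+β≤3m)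
      where
      arith : ∀ x b → 1ℚ * ((x + x) + b) + (x - b) ≡ x * (1ℚ + 1ℚ + 1ℚ)
      arith = solve-∀ ℚ-ring
      2m+β≤3m : 1ℚ * (ℕ→ℚ (m ℕ.+ m) + β) ≤ ℕ→ℚ m * three
      2m+β≤3m = ≤-difference (p≤q⇒0≤q-p β≤m)
        (trans (cong (λ k → 1ℚ * (k + β) + (ℕ→ℚ m - β)) (ℕ→ℚ-+ m m)) (arith (ℕ→ℚ m) β))

  H-unbounded : Unbounded H
  H-unbounded M = doubled t , λ n doubled-t≤n → begin-strict
    M                       <⟨ M<t/3 t ℕ.≤-refl ⟩
    recip three * ℕ→ℚ t     ≤⟨ H-doubled t ⟩
    H (doubled t)           ≤⟨ recipSum-mono-≤ 0<j+β {doubled t} {n} doubled-t≤n ⟩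
    H n                     ∎
    where
    open ≤-Reasoning
    m : ℕ
    m = proj₁ (archimedean β)
    t : ℕ
    t = proj₁ (unbounded-*ˡ (recip-pos 0<three) ℕ→ℚ-unbounded M)
    M<t/3 : ∀ n → t ℕ.≤ n → M < recip three * ℕ→ℚ n
    M<t/3 = proj₂ (unbounded-*ˡ (recip-pos 0<three) ℕ→ℚ-unbounded M)
    doubled : ℕ → ℕ
    doubled zero    = m
    doubled (suc k) = doubled k ℕ.+ doubled k
    β≤doubled : ∀ k → β ≤ ℕ→ℚ (doubled k)
    β≤doubled zero    = <⇒≤ (proj₂ (archimedean β))
    β≤doubled (suc k) = ≤-trans (β≤doubled k) (ℕ→ℚ-mono-≤ (ℕ.m≤m+n (doubled k) (doubled k)))
    H-doubled : ∀ k → recip three * ℕ→ℚ k ≤ H (doubled k)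
    H-doubled zero    = ≤-trans (≤-reflexive (*-zeroʳ (recip three))) (recipSum-nonNeg 0<j+β m)
    H-doubled (suc k) = begin
      recip three * ℕ→ℚ (suc k)           ≡⟨ cong (recip three *_) (ℕ→ℚ-suc k) ⟩
      recip three * (ℕ→ℚ k + 1ℚ)          ≡⟨ distrib (recip three) (ℕ→ℚ k) ⟩
      recip three * ℕ→ℚ k + recip three   ≤⟨ +-monoˡ-≤ (recip three) (H-doubled k) ⟩
      H (doubled k) + recip three         ≤⟨ H-doubling {doubled k} (β≤doubled k) ⟩
      H (doubled (suc k))                 ∎
      where
      distrib : ∀ a x → a * (x + 1ℚ) ≡ a * x + a
      distrib = solve-∀ ℚ-ring

shifted-harmonic-unbounded : ∀ {K a} → 0ℚ < ℕ→ℚ K + a → Unbounded (recipSum (λ j → ℕ→ℚ (j ℕ.+ K) + a))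
shifted-harmonic-unbounded {K} {a} 0<K+a =
  unbounded-mono {Harmonic.H 0<K+a} {recipSum (λ j → ℕ→ℚ (j ℕ.+ K) + a)}
    (λ n → ≤-reflexive (recipSum-cong (λ j → sym (ℕ→ℚ-shift j K a)) n)) (Harmonic.H-unbounded 0<K+a)

casoratian : (ℕ → ℚ) → (ℕ → ℚ) → ℚ
casoratian u v = u 0 * v 1 - u 1 * v 0

casoratian-1ˡ : ∀ w → casoratian (λ _ → 1ℚ) w ≡ w 1 - w 0
casoratian-1ˡ w = ones (w 0) (w 1)
  where
  ones : ∀ x y → 1ℚ * y - 1ℚ * x ≡ y - x
  ones = solve-∀ ℚ-ring

casoratian-1ʳ : ∀ w → casoratian w (λ _ → 1ℚ) ≡ w 0 - w 1
casoratian-1ʳ w = ones (w 0) (w 1)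
  where
  ones : ∀ x y → x * 1ℚ - y * 1ℚ ≡ x - y
  ones = solve-∀ ℚ-ring

casoratian≢0⇒linIndep : ∀ {u v} → casoratian u v ≢ 0ℚ → LinIndep u v
casoratian≢0⇒linIndep {u} {v} W≢0 a b a*u+b*v≡0 =
  p*q≡0⇒q≡0 W≢0 (begin
    casoratian u v * a                                      ≡⟨ eliminate-b (u 0) (u 1) (v 0) (v 1) a b ⟩
    v 1 * (a * u 0 + b * v 0) - v 0 * (a * u 1 + b * v 1)  ≡⟨ vanishes (v 1) (v 0) ⟩
    0ℚ                                                      ∎) ,
  p*q≡0⇒q≡0 W≢0 (begin
    casoratian u v * b                                      ≡⟨ eliminate-a (u 0) (u 1) (v 0) (v 1) a b ⟩
    u 0 * (a * u 1 + b * v 1) - u 1 * (a * u 0 + b * v 0)  ≡⟨ vanishes (u 0) (u 1) ⟩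
    0ℚ                                                      ∎)
  where
  open ≡-Reasoning
  eliminate-b : ∀ u₀ u₁ v₀ v₁ a b →
    (u₀ * v₁ - u₁ * v₀) * a ≡ v₁ * (a * u₀ + b * v₀) - v₀ * (a * u₁ + b * v₁)
  eliminate-b = solve-∀ ℚ-ring
  eliminate-a : ∀ u₀ u₁ v₀ v₁ a b →
    (u₀ * v₁ - u₁ * v₀) * b ≡ u₀ * (a * u₁ + b * v₁) - u₁ * (a * u₀ + b * v₀)
  eliminate-a = solve-∀ ℚ-ring
  zeros : ∀ p q → p * 0ℚ - q * 0ℚ ≡ 0ℚ
  zeros = solve-∀ ℚ-ring
  vanishes : ∀ {i j} p q → p * (a * u i + b * v i) - q * (a * u j + b * v j) ≡ 0ℚ
  vanishes {i} {j} p q = trans (cong₂ (λ x y → p * x - q * y) (a*u+b*v≡0 i) (a*u+b*v≡0 j)) (zeros p q)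

module Recurrence (α γ₀ : ℚ) where

  solution-linear : ∀ {u v} → IsSolution α γ₀ u → IsSolution α γ₀ v →
                    ∀ a b → IsSolution α γ₀ (λ n → a * u n + b * v n)
  solution-linear {u} {v} u-sol v-sol a b m = begin
    C * (a * u (2 ℕ.+ m) + b * v (2 ℕ.+ m))             ≡⟨ distrib C a b (u (2 ℕ.+ m)) (v (2 ℕ.+ m)) ⟩
    a * (C * u (2 ℕ.+ m)) + b * (C * v (2 ℕ.+ m))       ≡⟨ cong₂ (λ x y → a * x + b * y) (u-sol m) (v-sol m) ⟩
    a * (B * u (1 ℕ.+ m) - D * u m) + b * (B * v (1 ℕ.+ m) - D * v m)
                                                        ≡⟨ regroup B D a b (u (1 ℕ.+ m)) (u m) (v (1 ℕ.+ m)) (v m) ⟩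
    B * (a * u (1 ℕ.+ m) + b * v (1 ℕ.+ m)) - D * (a * u m + b * v m) ∎
    where
    open ≡-Reasoning
    C : ℚ
    C = ℕ→ℚ (suc m) + α
    B : ℚ
    B = ℕ→ℚ (2 ℕ.* suc m) + (α + γ₀)
    D : ℚ
    D = ℕ→ℚ (suc m) + γ₀
    distrib : ∀ c a b x y → c * (a * x + b * y) ≡ a * (c * x) + b * (c * y)
    distrib = solve-∀ ℚ-ring
    regroup : ∀ B D a b x₁ x₀ y₁ y₀ →
      a * (B * x₁ - D * x₀) + b * (B * y₁ - D * y₀) ≡ B * (a * x₁ + b * y₁) - D * (a * x₀ + b * y₀)
    regroup = solve-∀ ℚ-ring

  solution-scale : ∀ {u} → IsSolution α γ₀ u → ∀ c → IsSolution α γ₀ (λ n → c * u n)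
  solution-scale {u} u-sol c m = begin
    C * (c * u (2 ℕ.+ m))               ≡⟨ swap C c (u (2 ℕ.+ m)) ⟩
    c * (C * u (2 ℕ.+ m))               ≡⟨ cong (c *_) (u-sol m) ⟩
    c * (B * u (1 ℕ.+ m) - D * u m)     ≡⟨ regroup B D c (u (1 ℕ.+ m)) (u m) ⟩
    B * (c * u (1 ℕ.+ m)) - D * (c * u m) ∎
    where
    open ≡-Reasoning
    C : ℚ
    C = ℕ→ℚ (suc m) + α
    B : ℚ
    B = ℕ→ℚ (2 ℕ.* suc m) + (α + γ₀)
    D : ℚ
    D = ℕ→ℚ (suc m) + γ₀
    swap : ∀ a b x → a * (b * x) ≡ b * (a * x)
    swap = solve-∀ ℚ-ring
    regroup : ∀ B D c x₁ x₀ → c * (B * x₁ - D * x₀) ≡ B * (c * x₁) - D * (c * x₀)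
    regroup = solve-∀ ℚ-ring

  -- In the paper's indexing the recurrence reads (n+α)(u_n − u_{n−1}) = (n+γ₀)(u_{n−1} − u_{n−2}).
  solution-from-differences : ∀ {u} →
    (∀ m → (ℕ→ℚ (suc m) + α) * (u (2 ℕ.+ m) - u (1 ℕ.+ m)) ≡ (ℕ→ℚ (suc m) + γ₀) * (u (1 ℕ.+ m) - u m)) →
    IsSolution α γ₀ u
  solution-from-differences {u} differences m = begin
    (s + α) * u (2 ℕ.+ m)                          ≡⟨ split s α (u (2 ℕ.+ m)) (u (1 ℕ.+ m)) ⟩
    (s + α) * (u (2 ℕ.+ m) - u (1 ℕ.+ m)) + (s + α) * u (1 ℕ.+ m)
                                                   ≡⟨ cong (_+ (s + α) * u (1 ℕ.+ m)) (differences m) ⟩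
    (s + γ₀) * (u (1 ℕ.+ m) - u m) + (s + α) * u (1 ℕ.+ m)
                                                   ≡⟨ regroup s α γ₀ (u (1 ℕ.+ m)) (u m) ⟩
    (s + s + (α + γ₀)) * u (1 ℕ.+ m) - (s + γ₀) * u m
                                                   ≡⟨ cong (λ x → (x + (α + γ₀)) * u (1 ℕ.+ m) - (s + γ₀) * u m)
                                                           (ℕ→ℚ-double (suc m)) ⟨
    (ℕ→ℚ (2 ℕ.* suc m) + (α + γ₀)) * u (1 ℕ.+ m) - (s + γ₀) * u m ∎
    where
    open ≡-Reasoning
    s : ℚ
    s = ℕ→ℚ (suc m)
    split : ∀ s a x₂ x₁ → (s + a) * x₂ ≡ (s + a) * (x₂ - x₁) + (s + a) * x₁
    split = solve-∀ ℚ-ring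
    regroup : ∀ s a g x₁ x₀ → (s + g) * (x₁ - x₀) + (s + a) * x₁ ≡ (s + s + (a + g)) * x₁ - (s + g) * x₀
    regroup = solve-∀ ℚ-ring

  const-solution : IsSolution α γ₀ (λ _ → 1ℚ)
  const-solution = solution-from-differences λ m → both-zero (ℕ→ℚ (suc m) + α) (ℕ→ℚ (suc m) + γ₀)
    where
    both-zero : ∀ a b → a * (1ℚ - 1ℚ) ≡ b * (1ℚ - 1ℚ)
    both-zero = solve-∀ ℚ-ring

  first-order-solution : ∀ {x} → (∀ n → (ℕ→ℚ n + α) * x (suc n) ≡ (ℕ→ℚ (suc n) + γ₀) * x n) →
                         IsSolution α γ₀ x
  first-order-solution {x} step = solution-from-differences differences
    where
    differences : ∀ m → (ℕ→ℚ (suc m) + α) * (x (2 ℕ.+ m) - x (1 ℕ.+ m)) ≡ (ℕ→ℚ (suc m) + γ₀) * (x (1 ℕ.+ m) - x m)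
    differences m = begin
      (s + α) * (x (2 ℕ.+ m) - x (1 ℕ.+ m))      ≡⟨ distrib-sub (s + α) (x (2 ℕ.+ m)) (x (1 ℕ.+ m)) ⟩
      (s + α) * x (2 ℕ.+ m) - (s + α) * x (1 ℕ.+ m)
                                                 ≡⟨ cong (_- (s + α) * x (1 ℕ.+ m)) (step (suc m)) ⟩
      (ℕ→ℚ (2 ℕ.+ m) + γ₀) * x (1 ℕ.+ m) - (s + α) * x (1 ℕ.+ m)
                                                 ≡⟨ cong₂ (λ p q → (p + γ₀) * x (1 ℕ.+ m) - (q + α) * x (1 ℕ.+ m))
                                                          (trans (ℕ→ℚ-suc (suc m)) (cong (_+ 1ℚ) (ℕ→ℚ-suc m))) (ℕ→ℚ-suc m) ⟩
      (a + 1ℚ + 1ℚ + γ₀) * x (1 ℕ.+ m) - (a + 1ℚ + α) * x (1 ℕ.+ m)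
                                                 ≡⟨ regroup a α γ₀ (x (1 ℕ.+ m)) ⟩
      (a + 1ℚ + γ₀) * x (1 ℕ.+ m) - (a + α) * x (1 ℕ.+ m)
                                                 ≡⟨ cong₂ (λ p q → (p + γ₀) * x (1 ℕ.+ m) - q) (ℕ→ℚ-suc m) (sym (step m)) ⟨
      (s + γ₀) * x (1 ℕ.+ m) - (s + γ₀) * x m    ≡⟨ distrib-sub (s + γ₀) (x (1 ℕ.+ m)) (x m) ⟨
      (s + γ₀) * (x (1 ℕ.+ m) - x m)             ∎
      where
      open ≡-Reasoning
      a : ℚ
      a = ℕ→ℚ m
      s : ℚ
      s = ℕ→ℚ (suc m)
      regroup : ∀ a α γ y → (a + 1ℚ + 1ℚ + γ) * y - (a + 1ℚ + α) * y ≡ (a + 1ℚ + γ) * y - (a + α) * y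
      regroup = solve-∀ ℚ-ring
      distrib-sub : ∀ c y z → c * (y - z) ≡ c * y - c * z
      distrib-sub = solve-∀ ℚ-ring

module Minimality {α γ₀ : ℚ} (n+α≢0 : ∀ n → ℕ→ℚ n + α ≢ 0ℚ) where
  open Recurrence α γ₀

  solution-unique : ∀ {u v} → IsSolution α γ₀ u → IsSolution α γ₀ v →
                    u 0 ≡ v 0 → u 1 ≡ v 1 → ∀ n → u n ≡ v n
  solution-unique {u} {v} u-sol v-sol u₀≡v₀ u₁≡v₁ n = proj₁ (agree n)
    where
    agree : ∀ n → u n ≡ v n × u (suc n) ≡ v (suc n)
    agree zero    = u₀≡v₀ , u₁≡v₁
    agree (suc n) = proj₂ (agree n) , *-cancelˡ-≢0 (ℕ→ℚ (suc n) + α) (n+α≢0 (suc n)) (begin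
      (ℕ→ℚ (suc n) + α) * u (2 ℕ.+ n)            ≡⟨ u-sol n ⟩
      B * u (suc n) - D * u n                     ≡⟨ cong₂ (λ x y → B * x - D * y) (proj₂ (agree n)) (proj₁ (agree n)) ⟩
      B * v (suc n) - D * v n                     ≡⟨ v-sol n ⟨
      (ℕ→ℚ (suc n) + α) * v (2 ℕ.+ n)            ∎)
      where
      open ≡-Reasoning
      B : ℚ
      B = ℕ→ℚ (2 ℕ.* suc n) + (α + γ₀)
      D : ℚ
      D = ℕ→ℚ (suc n) + γ₀

  solution-basis : ∀ {m w u} → IsSolution α γ₀ m → IsSolution α γ₀ w → casoratian m w ≢ 0ℚ →
                   IsSolution α γ₀ u → ∃₂ λ A B → ∀ n → u n ≡ A * m n + B * w n
  solution-basis {m} {w} {u} m-sol w-sol W≢0 u-sol =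
    A , B , solution-unique u-sol (solution-linear m-sol w-sol A B) initial₀ initial₁
    where
    W : ℚ
    W = casoratian m w
    A : ℚ
    A = (u 0 * w 1 - u 1 * w 0) * recip W
    B : ℚ
    B = (m 0 * u 1 - m 1 * u 0) * recip W
    cramer₀ : ∀ u₀ u₁ m₀ m₁ w₀ w₁ i →
      (u₀ * w₁ - u₁ * w₀) * i * m₀ + (m₀ * u₁ - m₁ * u₀) * i * w₀ ≡ u₀ * ((m₀ * w₁ - m₁ * w₀) * i)
    cramer₀ = solve-∀ ℚ-ring
    cramer₁ : ∀ u₀ u₁ m₀ m₁ w₀ w₁ i →
      (u₀ * w₁ - u₁ * w₀) * i * m₁ + (m₀ * u₁ - m₁ * u₀) * i * w₁ ≡ u₁ * ((m₀ * w₁ - m₁ * w₀) * i)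
    cramer₁ = solve-∀ ℚ-ring
    cancel : ∀ x → x * (W * recip W) ≡ x
    cancel x = trans (cong (x *_) (recip-inverseʳ W≢0)) (*-identityʳ x)
    initial₀ : u 0 ≡ A * m 0 + B * w 0
    initial₀ = sym (trans (cramer₀ (u 0) (u 1) (m 0) (m 1) (w 0) (w 1) (recip W)) (cancel (u 0)))
    initial₁ : u 1 ≡ A * m 1 + B * w 1
    initial₁ = sym (trans (cramer₁ (u 0) (u 1) (m 0) (m 1) (w 0) (w 1) (recip W)) (cancel (u 1)))

  module _ {m w : ℕ → ℚ} (m-sol : IsSolution α γ₀ m) (w-sol : IsSolution α γ₀ w)
           (m₀≢0 : m 0 ≢ 0ℚ) (W≢0 : casoratian m w ≢ 0ℚ) (m/w→0 : RatioTendsToZero m w)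
           {u : ℕ → ℚ} (u-sol : IsSolution α γ₀ u) where

    -- Writing u = A m + B w and v = A′ m + B′ w, m = o(w) gives v = O(w), so u = o(v) forces B = 0.
    minimal⇒multiple : Minimal α γ₀ u → ∃ λ A → ∀ n → u n ≡ A * m n
    minimal⇒multiple (v , v-sol , _ , u/v→0) = A , u≡Am
      where
      A : ℚ
      A = proj₁ (solution-basis m-sol w-sol W≢0 u-sol)
      B : ℚ
      B = proj₁ (proj₂ (solution-basis m-sol w-sol W≢0 u-sol))
      u≡Am+Bw : ∀ n → u n ≡ A * m n + B * w n
      u≡Am+Bw = proj₂ (proj₂ (solution-basis m-sol w-sol W≢0 u-sol))
      A′ : ℚ
      A′ = proj₁ (solution-basis m-sol w-sol W≢0 v-sol)
      B′ : ℚ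
      B′ = proj₁ (proj₂ (solution-basis m-sol w-sol W≢0 v-sol))
      v≡A′m+B′w : ∀ n → v n ≡ A′ * m n + B′ * w n
      v≡A′m+B′w = proj₂ (proj₂ (solution-basis m-sol w-sol W≢0 v-sol))
      v=O[w] : Eventually (λ n → ∣ v n ∣ ≤ (∣ A′ ∣ + ∣ B′ ∣) * ∣ w n ∣)
      v=O[w] = eventually-map bound (m/w→0 1ℚ (positive⁻¹ 1ℚ))
        where
        bound : ∀ {n} → ∣ m n ∣ < 1ℚ * ∣ w n ∣ → ∣ v n ∣ ≤ (∣ A′ ∣ + ∣ B′ ∣) * ∣ w n ∣
        bound {n} ∣mₙ∣<∣wₙ∣ = subst (λ x → ∣ x ∣ ≤ (∣ A′ ∣ + ∣ B′ ∣) * ∣ w n ∣) (sym (v≡A′m+B′w n))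
          (∣a*x+b*y∣≤[∣a∣+∣b∣]*∣y∣ A′ B′ (<⇒≤ (subst (∣ m n ∣ <_) (*-identityˡ ∣ w n ∣) ∣mₙ∣<∣wₙ∣)))
      u/w→0 : RatioTendsToZero u w
      u/w→0 = ratio-O-trans (+-mono-≤ (0≤∣p∣ A′) (0≤∣p∣ B′)) v=O[w] u/v→0
      B≡0 : B ≡ 0ℚ
      B≡0 = ratio-*-self⇒≡0 (ratio-cong isolate (ratio-+ u/w→0 (ratio-*ˡ (- A) m/w→0)))
        where
        cancel : ∀ a b x y → (a * x + b * y) + - a * x ≡ b * y
        cancel = solve-∀ ℚ-ring
        isolate : ∀ n → u n + - A * m n ≡ B * w n
        isolate n = trans (cong (_+ - A * m n) (u≡Am+Bw n)) (cancel A B (m n) (w n))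
      u≡Am : ∀ n → u n ≡ A * m n
      u≡Am n = trans (u≡Am+Bw n) (trans (cong (λ b → A * m n + b * w n) B≡0)
        (trans (cong (A * m n +_) (*-zeroˡ (w n))) (+-identityʳ (A * m n))))

    minimal⇒proportional : NonTrivial u → Minimal α γ₀ u → u 0 ≢ 0ℚ × m 0 * u 1 ≡ m 1 * u 0
    minimal⇒proportional u≢0 minimal = u₀≢0 , cross
      where
      A : ℚ
      A = proj₁ (minimal⇒multiple minimal)
      u≡Am : ∀ n → u n ≡ A * m n
      u≡Am = proj₂ (minimal⇒multiple minimal)
      u₀≢0 : u 0 ≢ 0ℚ
      u₀≢0 u₀≡0 = u≢0 λ n → trans (u≡Am n) (trans (cong (_* m n) A≡0) (*-zeroˡ (m n)))
        where
        A≡0 : A ≡ 0ℚ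
        A≡0 = p*q≡0⇒q≡0 m₀≢0 (trans (*-comm (m 0) A) (trans (sym (u≡Am 0)) u₀≡0))
      cross : m 0 * u 1 ≡ m 1 * u 0
      cross = begin
        m 0 * u 1          ≡⟨ cong (m 0 *_) (u≡Am 1) ⟩
        m 0 * (A * m 1)    ≡⟨ swap (m 0) A (m 1) ⟩
        m 1 * (A * m 0)    ≡⟨ cong (m 1 *_) (u≡Am 0) ⟨
        m 1 * u 0          ∎
        where
        open ≡-Reasoning
        swap : ∀ x a y → x * (a * y) ≡ y * (a * x)
        swap = solve-∀ ℚ-ring

    proportional⇒minimal : u 0 ≢ 0ℚ × m 0 * u 1 ≡ m 1 * u 0 → Minimal α γ₀ u
    proportional⇒minimal (u₀≢0 , cross) =
      w , w-sol , casoratian≢0⇒linIndep W[u,w]≢0 , ratio-cong (λ n → sym (u≡Dm n)) (ratio-*ˡ D m/w→0)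
      where
      D : ℚ
      D = u 0 * recip (m 0)
      u₀≡Dm₀ : u 0 ≡ D * m 0
      u₀≡Dm₀ = trans (sym (*-recip-cancelˡ (u 0) m₀≢0)) (*-comm (m 0) D)
      u₁≡Dm₁ : u 1 ≡ D * m 1
      u₁≡Dm₁ = *-cancelˡ-≢0 (m 0) m₀≢0 (begin
        m 0 * u 1          ≡⟨ cross ⟩
        m 1 * u 0          ≡⟨ cong (m 1 *_) u₀≡Dm₀ ⟩
        m 1 * (D * m 0)    ≡⟨ swap (m 1) D (m 0) ⟩
        m 0 * (D * m 1)    ∎)
        where
        open ≡-Reasoning
        swap : ∀ x a y → x * (a * y) ≡ y * (a * x)
        swap = solve-∀ ℚ-ring
      u≡Dm : ∀ n → u n ≡ D * m n
      u≡Dm = solution-unique u-sol (solution-scale m-sol D) u₀≡Dm₀ u₁≡Dm₁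
      W[u,w]≢0 : casoratian u w ≢ 0ℚ
      W[u,w]≢0 W[u,w]≡0 = W≢0 (p*q≡0⇒q≡0 D≢0 (begin
        D * casoratian m w                          ≡⟨ factor D (m 0) (m 1) (w 0) (w 1) ⟩
        D * m 0 * w 1 - D * m 1 * w 0               ≡⟨ cong₂ (λ x y → x * w 1 - y * w 0) u₀≡Dm₀ u₁≡Dm₁ ⟨
        casoratian u w                              ≡⟨ W[u,w]≡0 ⟩
        0ℚ                                          ∎))
        where
        open ≡-Reasoning
        factor : ∀ d m₀ m₁ w₀ w₁ → d * (m₀ * w₁ - m₁ * w₀) ≡ d * m₀ * w₁ - d * m₁ * w₀
        factor = solve-∀ ℚ-ring
        D≢0 : D ≢ 0ℚ
        D≢0 D≡0 = u₀≢0 (trans u₀≡Dm₀ (trans (cong (_* m 0) D≡0) (*-zeroˡ (m 0))))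

    minimal⇔proportional : NonTrivial u → Minimal α γ₀ u ⇔ (u 0 ≢ 0ℚ × m 0 * u 1 ≡ m 1 * u 0)
    minimal⇔proportional u≢0 = mk⇔ (minimal⇒proportional u≢0) proportional⇒minimal

  minimal⇔constant : ∀ {w u} → IsSolution α γ₀ w → casoratian (λ _ → 1ℚ) w ≢ 0ℚ →
    RatioTendsToZero (λ _ → 1ℚ) w → IsSolution α γ₀ u → NonTrivial u →
    Minimal α γ₀ u ⇔ (u 0 ≢ 0ℚ × u 1 ≡ 1ℚ * u 0)
  minimal⇔constant {w} {u} w-sol W≢0 1=o[w] u-sol u≢0 = mk⇔
    (λ minimal → map₂ (trans (sym (*-identityˡ (u 1)))) (Equivalence.to proportional minimal))
    (λ constant → Equivalence.from proportional (map₂ (trans (*-identityˡ (u 1))) constant))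
    where
    proportional : Minimal α γ₀ u ⇔ (u 0 ≢ 0ℚ × 1ℚ * u 1 ≡ 1ℚ * u 0)
    proportional = minimal⇔proportional const-solution w-sol 1≢0 W≢0 1=o[w] u-sol u≢0

module ExplicitSolutions {α γ₀ : ℚ} (n+α≢0 : ∀ n → ℕ→ℚ n + α ≢ 0ℚ) (n+γ₀≢0 : ∀ n → ℕ→ℚ n + γ₀ ≢ 0ℚ) where
  open Recurrence α γ₀

  α≢0 : α ≢ 0ℚ
  α≢0 α≡0 = n+α≢0 0 (trans (+-identityˡ α) α≡0)

  -- P k = α (γ₀+1)_k / (α)_k with Pochhammer symbols, i.e. u_n = α (γ₀+1)_{n+1} / (α)_{n+1}.
  P : ℕ → ℚ
  P zero    = α
  P (suc n) = P n * ((ℕ→ℚ (suc n) + γ₀) * recip (ℕ→ℚ n + α))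

  P-step : ∀ n → (ℕ→ℚ n + α) * P (suc n) ≡ (ℕ→ℚ (suc n) + γ₀) * P n
  P-step n = begin
    t * (P n * (g * recip t))   ≡⟨ rearrange t (P n) g (recip t) ⟩
    g * P n * (t * recip t)     ≡⟨ cong (g * P n *_) (recip-inverseʳ (n+α≢0 n)) ⟩
    g * P n * 1ℚ                ≡⟨ *-identityʳ (g * P n) ⟩
    g * P n                     ∎
    where
    open ≡-Reasoning
    t : ℚ
    t = ℕ→ℚ n + α
    g : ℚ
    g = ℕ→ℚ (suc n) + γ₀
    rearrange : ∀ t p g i → t * (p * (g * i)) ≡ g * p * (t * i)
    rearrange = solve-∀ ℚ-ring

  P-solution : IsSolution α γ₀ P
  P-solution = first-order-solution P-step

  P-one : P 1 ≡ γ₀ + 1ℚ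
  P-one = *-cancelˡ-≢0 α α≢0 (begin
    α * P 1               ≡⟨ cong (_* P 1) (+-identityˡ α) ⟨
    (ℕ→ℚ 0 + α) * P 1     ≡⟨ P-step 0 ⟩
    (ℕ→ℚ 1 + γ₀) * α      ≡⟨ swap γ₀ α ⟩
    α * (γ₀ + 1ℚ)         ∎)
    where
    open ≡-Reasoning
    swap : ∀ g a → (1ℚ + g) * a ≡ a * (g + 1ℚ)
    swap = solve-∀ ℚ-ring

  P≢0 : ∀ n → P n ≢ 0ℚ
  P≢0 zero    = α≢0
  P≢0 (suc n) Pₙ₊₁≡0 = P≢0 n (p*q≡0⇒q≡0 (n+γ₀≢0 (suc n))
    (trans (sym (P-step n)) (trans (cong ((ℕ→ℚ n + α) *_) Pₙ₊₁≡0) (*-zeroʳ (ℕ→ℚ n + α)))))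

  W[1,P]≢0 : α < γ₀ + 1ℚ → casoratian (λ _ → 1ℚ) P ≢ 0ℚ
  W[1,P]≢0 α<γ₀+1 W≡0 = pos⇒≢0 (p<q⇒0<q-p α<γ₀+1)
    (trans (cong (_- α) (sym P-one)) (trans (sym (casoratian-1ˡ P)) W≡0))

  W[P,1]≢0 : γ₀ + 1ℚ < α → casoratian P (λ _ → 1ℚ) ≢ 0ℚ
  W[P,1]≢0 γ₀+1<α W≡0 = pos⇒≢0 (p<q⇒0<q-p γ₀+1<α)
    (trans (cong (λ p → α - p) (sym P-one)) (trans (sym (casoratian-1ʳ P)) W≡0))

  1=o[P] : α < γ₀ + 1ℚ → RatioTendsToZero (λ _ → 1ℚ) P
  1=o[P] α<γ₀+1 = unbounded⇒ratio-1 λ M → eventually-unshift K (y-unbounded M)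
    where
    K : ℕ
    K = proj₁ (positive-shift α)
    0<K+α : 0ℚ < ℕ→ℚ K + α
    0<K+α = proj₂ (positive-shift α)
    c : ℚ
    c = γ₀ + 1ℚ - α
    0<c : 0ℚ < c
    0<c = p<q⇒0<q-p α<γ₀+1
    t : ℕ → ℚ
    t j = ℕ→ℚ (j ℕ.+ K) + α
    y : ℕ → ℚ
    y j = ∣ P (j ℕ.+ K) ∣
    t+c : ∀ j → ℕ→ℚ (suc (j ℕ.+ K)) + γ₀ ≡ t j + c
    t+c j = trans (cong (_+ γ₀) (ℕ→ℚ-suc (j ℕ.+ K))) (arith (ℕ→ℚ (j ℕ.+ K)) α γ₀)
      where
      arith : ∀ n a g → n + 1ℚ + g ≡ n + a + (g + 1ℚ - a)
      arith = solve-∀ ℚ-ring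
    step : ∀ j → t j * y (suc j) ≡ (t j + c) * y j
    step j = *-cong-∣∣ (shift-pos 0<K+α j) (+-mono-< (shift-pos 0<K+α j) 0<c)
      (trans (P-step (j ℕ.+ K)) (cong (_* P (j ℕ.+ K)) (t+c j)))
    y-unbounded : Unbounded y
    y-unbounded = unbounded-mono {λ j → y 0 * (1ℚ + c * recipSum t j)} {y}
      (recipSum-growth (shift-pos 0<K+α) (<⇒≤ 0<c) (0≤∣p∣ (P K)) step)
      (unbounded-*ˡ (∣p∣-pos (P≢0 K)) (unbounded-+ˡ 1ℚ (unbounded-*ˡ 0<c (shifted-harmonic-unbounded 0<K+α))))

  P=o[1] : γ₀ + 1ℚ < α → RatioTendsToZero P (λ _ → 1ℚ)
  P=o[1] γ₀+1<α ε 0<ε = eventually-unshift K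
    (eventually-map (λ {j} yⱼ<ε → subst (∣ P (j ℕ.+ K) ∣ <_) (sym (*-identityʳ ε)) yⱼ<ε)
      (weighted-bound⇒small (λ j → 0≤∣p∣ (P (j ℕ.+ K))) (0≤∣p∣ (P K))
        (unbounded-+ˡ 1ℚ (unbounded-*ˡ 0<c (shifted-harmonic-unbounded 0<K+γ₀+1)))
        (recipSum-decay (shift-pos 0<K+γ₀+1) (<⇒≤ 0<c) (λ j → 0≤∣p∣ (P (j ℕ.+ K))) step) ε 0<ε))
    where
    K : ℕ
    K = proj₁ (positive-shift (γ₀ + 1ℚ))
    0<K+γ₀+1 : 0ℚ < ℕ→ℚ K + (γ₀ + 1ℚ)
    0<K+γ₀+1 = proj₂ (positive-shift (γ₀ + 1ℚ))
    c : ℚ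
    c = α - (γ₀ + 1ℚ)
    0<c : 0ℚ < c
    0<c = p<q⇒0<q-p γ₀+1<α
    s : ℕ → ℚ
    s j = ℕ→ℚ (j ℕ.+ K) + (γ₀ + 1ℚ)
    s≡ : ∀ j → ℕ→ℚ (suc (j ℕ.+ K)) + γ₀ ≡ s j
    s≡ j = trans (cong (_+ γ₀) (ℕ→ℚ-suc (j ℕ.+ K))) (arith (ℕ→ℚ (j ℕ.+ K)) γ₀)
      where
      arith : ∀ n g → n + 1ℚ + g ≡ n + (g + 1ℚ)
      arith = solve-∀ ℚ-ring
    s+c : ∀ j → ℕ→ℚ (j ℕ.+ K) + α ≡ s j + c
    s+c j = arith (ℕ→ℚ (j ℕ.+ K)) α γ₀
      where
      arith : ∀ n a g → n + a ≡ n + (g + 1ℚ) + (a - (g + 1ℚ))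
      arith = solve-∀ ℚ-ring
    step : ∀ j → (s j + c) * ∣ P (suc j ℕ.+ K) ∣ ≡ s j * ∣ P (j ℕ.+ K) ∣
    step j = *-cong-∣∣ (+-mono-< (shift-pos 0<K+γ₀+1 j) 0<c) (shift-pos 0<K+γ₀+1 j)
      (trans (cong (_* P (suc (j ℕ.+ K))) (sym (s+c j))) (trans (P-step (j ℕ.+ K)) (cong (_* P (j ℕ.+ K)) (s≡ j))))

  Q : ℕ → ℚ
  Q = recipSum (λ i → ℕ→ℚ i + α)

  Q-solution : α ≡ γ₀ + 1ℚ → IsSolution α γ₀ Q
  Q-solution α≡γ₀+1 = solution-from-differences differences
    where
    differences : ∀ m → (ℕ→ℚ (suc m) + α) * (Q (2 ℕ.+ m) - Q (1 ℕ.+ m)) ≡ (ℕ→ℚ (suc m) + γ₀) * (Q (1 ℕ.+ m) - Q m)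
    differences m = begin
      (s + α) * (Q (2 ℕ.+ m) - Q (1 ℕ.+ m))      ≡⟨ cong ((s + α) *_) (last-term (Q (1 ℕ.+ m)) (recip (s + α))) ⟩
      (s + α) * recip (s + α)                    ≡⟨ recip-inverseʳ (n+α≢0 (suc m)) ⟩
      1ℚ                                         ≡⟨ recip-inverseʳ (n+α≢0 m) ⟨
      (ℕ→ℚ m + α) * recip (ℕ→ℚ m + α)            ≡⟨ cong (_* recip (ℕ→ℚ m + α)) m+α≡s+γ₀ ⟩
      (s + γ₀) * recip (ℕ→ℚ m + α)               ≡⟨ cong ((s + γ₀) *_) (last-term (Q m) (recip (ℕ→ℚ m + α))) ⟨
      (s + γ₀) * (Q (1 ℕ.+ m) - Q m)             ∎
      where
      open ≡-Reasoning
      s : ℚ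
      s = ℕ→ℚ (suc m)
      last-term : ∀ q r → q + r - q ≡ r
      last-term = solve-∀ ℚ-ring
      arith : ∀ n g → n + (g + 1ℚ) ≡ n + 1ℚ + g
      arith = solve-∀ ℚ-ring
      m+α≡s+γ₀ : ℕ→ℚ m + α ≡ s + γ₀
      m+α≡s+γ₀ = trans (cong (ℕ→ℚ m +_) α≡γ₀+1) (trans (arith (ℕ→ℚ m) γ₀) (cong (_+ γ₀) (sym (ℕ→ℚ-suc m))))

  W[1,Q]≢0 : casoratian (λ _ → 1ℚ) Q ≢ 0ℚ
  W[1,Q]≢0 W≡0 = recip-≢0 (n+α≢0 0) (trans (sym (first-term (recip (ℕ→ℚ 0 + α))))
    (trans (sym (casoratian-1ˡ Q)) W≡0))
    where
    first-term : ∀ r → 0ℚ + r - 0ℚ ≡ r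
    first-term = solve-∀ ℚ-ring

  1=o[Q] : RatioTendsToZero (λ _ → 1ℚ) Q
  1=o[Q] = unbounded⇒ratio-1 λ M → eventually-unshift K (∣Q∣-unbounded M)
    where
    K : ℕ
    K = proj₁ (positive-shift α)
    0<K+α : 0ℚ < ℕ→ℚ K + α
    0<K+α = proj₂ (positive-shift α)
    t : ℕ → ℚ
    t j = ℕ→ℚ (j ℕ.+ K) + α
    ∣Q∣-unbounded : Unbounded (λ j → ∣ Q (j ℕ.+ K) ∣)
    ∣Q∣-unbounded = unbounded-mono {λ j → Q K + recipSum t j} {λ j → ∣ Q (j ℕ.+ K) ∣}
      (λ j → subst (_≤ ∣ Q (j ℕ.+ K) ∣) (recipSum-shift (λ i → ℕ→ℚ i + α) K j) (p≤∣p∣ (Q (j ℕ.+ K))))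
      (unbounded-+ˡ (Q K) (shifted-harmonic-unbounded 0<K+α))

proposition35 : (α γ₀ : ℚ) →
    (∀ (n : ℕ) → ℕ→ℚ n + α ≢ 0ℚ) →
    (∀ (n : ℕ) → ℕ→ℚ n + γ₀ ≢ 0ℚ) →
    (u : ℕ → ℚ) → IsSolution α γ₀ u → NonTrivial u →
    (α ≤ γ₀ + 1ℚ → (Minimal α γ₀ u ⇔ (u 0 ≢ 0ℚ × u 1 ≡ 1ℚ * u 0))) ×
    (γ₀ + 1ℚ < α → (Minimal α γ₀ u ⇔ (u 0 ≢ 0ℚ × α * u 1 ≡ (γ₀ + 1ℚ) * u 0)))
proposition35 α γ₀ n+α≢0 n+γ₀≢0 u u-sol u≢0 = unbounded-case , decaying-case
  where
  open Recurrence α γ₀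
  open Minimality n+α≢0
  open ExplicitSolutions n+α≢0 n+γ₀≢0

  unbounded-case : α ≤ γ₀ + 1ℚ → Minimal α γ₀ u ⇔ (u 0 ≢ 0ℚ × u 1 ≡ 1ℚ * u 0)
  unbounded-case α≤γ₀+1 with <-cmp α (γ₀ + 1ℚ)
  ... | tri< α<γ₀+1 _ _ = minimal⇔constant P-solution (W[1,P]≢0 α<γ₀+1) (1=o[P] α<γ₀+1) u-sol u≢0
  ... | tri≈ _ α≡γ₀+1 _ = minimal⇔constant (Q-solution α≡γ₀+1) W[1,Q]≢0 1=o[Q] u-sol u≢0
  ... | tri> _ _ γ₀+1<α = ⊥-elim (<-irrefl refl (<-≤-trans γ₀+1<α α≤γ₀+1))

  decaying-case : γ₀ + 1ℚ < α → Minimal α γ₀ u ⇔ (u 0 ≢ 0ℚ × α * u 1 ≡ (γ₀ + 1ℚ) * u 0)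
  decaying-case γ₀+1<α = subst (λ p → Minimal α γ₀ u ⇔ (u 0 ≢ 0ℚ × α * u 1 ≡ p * u 0)) P-one
    (minimal⇔proportional P-solution const-solution α≢0 (W[P,1]≢0 γ₀+1<α) (P=o[1] γ₀+1<α) u-sol u≢0)
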